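{- For $k\in\mathbb{Z}^+$ let $\alpha_k=3\cdot2^{\lfloor k/2\rfloor}$. Then $|\mathcal{T}(\alpha_k,[2^k3^2])|=\omega(2^{0.79k})$ as $k\to\infty$, i.e. $|\mathcal{T}(\alpha_k,[2^k3^2])|/2^{0.79k}\to\infty$.
   Context: $[n]=\{1,\dots,n\}$. $A+B$ is the Minkowski sum. For finite $C\subset\mathbb{Z}$ and $\alpha\in\mathbb{Z}^+$, $\mathcal{T}(\alpha,C)$ is the set of pairs $(A,B)$ of finite subsets of $\mathbb{Z}$ with $A+B=C$, $|C|=|A||B|$, $|A|=\alpha$, $0\in B$ and $\min B\ge0$. -}

module Defs where

open import Data.Nat as ℕ using (ℕ; _^_; _/_)
open import Data.Integer using (ℤ; +_; 0ℤ; _+_; _≤_; _<_)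
open import Data.List using (List; length)
open import Data.List.Membership.Propositional using (_∈_)
open import Data.List.Relation.Unary.All using (All)
open import Data.List.Relation.Unary.Linked using (Linked)
open import Data.Product using (Σ; ∃; _×_; ∃-syntax)
open import Data.Fin using (Fin)
open import Function.Bundles using (_⇔_)
open import Relation.Binary.PropositionalEquality using (_≡_)

-- A finite subset of ℤ is represented canonically by its strictly increasing
-- list of elements; its cardinality is the length of that list.

InSumset : List ℤ → List ℤ → ℤ → Set
InSumset A B c = ∃[ a ] ∃[ b ] (a ∈ A × b ∈ B × c ≡ a + b)

InInterval : ℕ → ℤ → Set
InInterval n c = (+ 1 ≤ c) × (c ≤ + n)

record TPair (α n : ℕ) : Set where
  field
    A B        : List ℤ
    A-sorted   : Linked _<_ A
    B-sorted   : Linked _<_ B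
    sumset     : ∀ c → InSumset A B c ⇔ InInterval n c
    card       : n ≡ length A ℕ.* length B
    cardA      : length A ≡ α
    zero∈B     : 0ℤ ∈ B
    B-nonneg   : All (0ℤ ≤_) B

AtLeast : ℕ → ℕ → ℕ → Set
AtLeast N α n = Σ (Fin N → TPair α n) λ f →
  ∀ i j → TPair.A (f i) ≡ TPair.A (f j) → TPair.B (f i) ≡ TPair.B (f j) → i ≡ j

αₖ : ℕ → ℕ
αₖ k = 3 ℕ.* 2 ^ (k / 2)

-- A tiling A ⊕ B of [0, m) with 0 ∈ A, B yields the tilings (A ∪ (m + A)) ⊕ B and A ⊕ (B ∪ (m + B))
-- of [0, 2m). Starting from {0,1,2} ⊕ {0,3,6} = [0, 9), every word v ∈ {A, B}^k thus gives a tiling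
-- of [0, 9·2^k) with |A| = 3·2^(number of A-steps), and distinct words give distinct tilings, since
-- m lies in the doubled set but in neither of the undoubled ones. The words with ⌊k/2⌋ A-steps give
-- C(k, ⌊k/2⌋) ≥ C(16, 8)^⌊k/16⌋ = 12870^⌊k/16⌋ elements of 𝒯(α_k, [9·2^k]) (after shifting A by one),
-- and log₂ 12870 / 16 > 0.853 > 0.79.
module Submission where

open import Defs
open import Data.Bool using (Bool; true; false; T?)
open import Data.Empty using (⊥-elim)
open import Data.Fin using (Fin; splitAt; join; cast; inject≤)
open import Data.Fin.Properties using (join-splitAt; cast-involutive; inject≤-injective)
open import Data.Integer as ℤ using (-[1+_]; +≤+; +<+) renaming (+_ to pos)
open import Data.Integer.Properties using (+-injective)
open import Data.List using (List; []; _∷_; _++_; map; length; filter)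
open import Data.List.Properties using (length-++; length-map; map-injective; filter-++; filter-all; filter-none; ++-identityʳ)
open import Data.List.Membership.Propositional using (_∈_; _∉_)
open import Data.List.Membership.Propositional.Properties using (∈-++⁺ˡ; ∈-++⁺ʳ; ∈-++⁻; ∈-map⁺; ∈-map⁻)
open import Data.List.Relation.Unary.All as All using (All; []; _∷_)
open import Data.List.Relation.Unary.All.Properties using () renaming (map⁺ to All-map⁺)
open import Data.List.Relation.Unary.Any using (here; there)
open import Data.List.Relation.Unary.Linked as Linked using (Linked; []; [-]; _∷_)
open import Data.List.Relation.Unary.Linked.Properties using () renaming (map⁺ to Linked-map⁺)
open import Data.Nat using (ℕ; zero; suc; _+_; _*_; _^_; _∸_; _/_; _%_; _≤_; _<_; _<?_; _≤?_; z≤n; s≤s)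
open import Data.Nat.Properties
open import Data.Nat.Combinatorics using (_C_; nCk+nC[k+1]≡[n+1]C[k+1])
open import Data.Nat.DivMod using (m≡m%n+[m/n]*n; m%n<n; m/n≤m; m*n/n≡m; +-distrib-/-∣ʳ; /-monoˡ-≤)
open import Data.Nat.Divisibility using (divides-refl)
open import Data.Nat.Tactic.RingSolver using (solve-∀)
open import Data.Product using (_×_; _,_; proj₁; proj₂; ∃-syntax; ∃₂; map₁; map₂)
open import Data.Sum using (_⊎_; inj₁; inj₂)
open import Data.Vec using (Vec; []; _∷_; replicate; count)
open import Data.Vec.Properties using (∷-injective)
open import Function using (_∘_)
open import Function.Bundles using (mk⇔)
open import Relation.Nullary.Decidable using (yes; no; toWitness)
open import Relation.Binary.PropositionalEquality

private variable
  A B X Y : List ℕ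
  k m n N N′ α : ℕ

Linked-++ : Linked _<_ X → All (_< m) X → All (m ≤_) Y → Linked _<_ Y → Linked _<_ (X ++ Y)
Linked-++              []          _            _           Y< = Y<
Linked-++ {Y = []}     [-]         _            _           _  = [-]
Linked-++ {Y = _ ∷ _}  [-]         (x<m ∷ [])   (m≤y ∷ _)   Y< = <-≤-trans x<m m≤y ∷ Y<
Linked-++              (x<x′ ∷ X<) (_ ∷ X<m)    m≤Y         Y< = x<x′ ∷ Linked-++ X< X<m m≤Y Y<

-- A ⊕ B = {0, …, m − 1}; the cardinality condition makes all sums a + b distinct.
record Tiling (A B : List ℕ) (m : ℕ) : Set where
  field
    A-sorted : Linked _<_ A
    B-sorted : Linked _<_ B
    sum<     : ∀ {a b} → a ∈ A → b ∈ B → a + b < m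
    covers   : ∀ {c} → c < m → ∃₂ λ a b → a ∈ A × b ∈ B × c ≡ a + b
    card     : length A * length B ≡ m
    0∈A      : 0 ∈ A
    0∈B      : 0 ∈ B

open Tiling

Tiling-swap : Tiling A B m → Tiling B A m
Tiling-swap t .A-sorted = t .B-sorted
Tiling-swap t .B-sorted = t .A-sorted
Tiling-swap {m = m} t .sum< {a} {b} a∈B b∈A = subst (_< m) (+-comm b a) (t .sum< b∈A a∈B)
Tiling-swap t .covers c<m with t .covers c<m
... | a , b , a∈A , b∈B , c≡a+b = b , a , b∈B , a∈A , trans c≡a+b (+-comm a b)
Tiling-swap {A} {B} t .card = trans (*-comm (length B) (length A)) (t .card)
Tiling-swap t .0∈A = t .0∈B
Tiling-swap t .0∈B = t .0∈A

Tiling-boundedˡ : Tiling A B m → All (_< m) A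
Tiling-boundedˡ t = All.tabulate λ {a} a∈A → subst (_< _) (+-identityʳ a) (t .sum< a∈A (t .0∈B))

double : ℕ → List ℕ → List ℕ
double m X = X ++ map (m +_) X

shifted-bounded : ∀ m X → All (m ≤_) (map (m +_) X)
shifted-bounded m X = All-map⁺ (All.universal (m≤m+n m) X)

length-double : ∀ m X → length (double m X) ≡ length X + length X
length-double m X = trans (length-++ X) (cong (length X +_) (length-map (m +_) X))


Tiling-doubleˡ : Tiling A B m → Tiling (double m A) B (m + m)
Tiling-doubleˡ {A} {B} {m} t = record
  { A-sorted = Linked-++ (t .A-sorted) (Tiling-boundedˡ t) (shifted-bounded m A)
                         (Linked-map⁺ (Linked.map (+-monoʳ-< m) (t .A-sorted)))
  ; B-sorted = t .B-sorted
  ; sum<     = double-sum<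
  ; covers   = double-covers
  ; card     = double-card
  ; 0∈A      = ∈-++⁺ˡ (t .0∈A)
  ; 0∈B      = t .0∈B
  }
  where
  double-sum< : ∀ {a b} → a ∈ double m A → b ∈ B → a + b < m + m
  double-sum< a∈ b∈B with ∈-++⁻ A a∈
  ... | inj₁ a∈A = <-≤-trans (t .sum< a∈A b∈B) (m≤m+n m m)
  ... | inj₂ m+a∈ with ∈-map⁻ (m +_) m+a∈
  ...   | a , a∈A , refl = subst (_< m + m) (sym (+-assoc m a _)) (+-monoʳ-< m (t .sum< a∈A b∈B))

  double-covers : ∀ {c} → c < m + m → ∃₂ λ a b → a ∈ double m A × b ∈ B × c ≡ a + b
  double-covers {c} c<2m with c <? m
  ... | yes c<m with t .covers c<m
  ...   | a , b , a∈A , b∈B , c≡a+b = a , b , ∈-++⁺ˡ a∈A , b∈B , c≡a+b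
  double-covers {c} c<2m | no c≮m with c ∸ m | m+[n∸m]≡n (≮⇒≥ c≮m)
  ... | d | refl with t .covers (+-cancelˡ-< m d m c<2m)
  ...   | a , b , a∈A , b∈B , d≡a+b =
    m + a , b , ∈-++⁺ʳ A (∈-map⁺ (m +_) a∈A) , b∈B , trans (cong (m +_) d≡a+b) (sym (+-assoc m a b))

  double-card : length (double m A) * length B ≡ m + m
  double-card = begin
    length (double m A) * length B            ≡⟨ cong (_* length B) (length-double m A) ⟩
    (length A + length A) * length B          ≡⟨ *-distribʳ-+ (length B) (length A) (length A) ⟩
    length A * length B + length A * length B ≡⟨ cong₂ _+_ (t .card) (t .card) ⟩
    m + m                                     ∎
    where open ≡-Reasoning

Tiling-doubleʳ : Tiling A B m → Tiling A (double m B) (m + m)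
Tiling-doubleʳ = Tiling-swap ∘ Tiling-doubleˡ ∘ Tiling-swap

filter-double : All (_< m) X → filter (_<? m) (double m X) ≡ X
filter-double {m} {X} X<m = begin
  filter (_<? m) (X ++ map (m +_) X)                        ≡⟨ filter-++ (_<? m) X _ ⟩
  filter (_<? m) X ++ filter (_<? m) (map (m +_) X)         ≡⟨ cong₂ _++_ (filter-all (_<? m) X<m) (filter-none (_<? m) (All.map ≤⇒≯ (shifted-bounded m X))) ⟩
  X ++ []                                                   ≡⟨ ++-identityʳ X ⟩
  X                                                         ∎
  where open ≡-Reasoning

double-injective : All (_< m) X → All (_< m) Y → double m X ≡ double m Y → X ≡ Y
double-injective {m} X<m Y<m eq =
  trans (sym (filter-double X<m)) (trans (cong (filter (_<? m)) eq) (filter-double Y<m))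

m∈double : 0 ∈ X → m ∈ double m X
m∈double {X} {m} 0∈X = subst (_∈ double m X) (+-identityʳ m) (∈-++⁺ʳ X (∈-map⁺ (m +_) 0∈X))

∉-bound : All (_< m) X → m ∉ X
∉-bound X<m m∈X = <-irrefl refl (All.lookup X<m m∈X)

2^k*m+2^k*m≡2^[1+k]*m : ∀ k m → 2 ^ k * m + 2 ^ k * m ≡ 2 ^ suc k * m
2^k*m+2^k*m≡2^[1+k]*m k m = twice (2 ^ k) m
  where
  twice : ∀ x m → x * m + x * m ≡ 2 * x * m
  twice = solve-∀

-- true doubles A, false doubles B; the head of v is the last step.
module Doubling {A₀ B₀ : List ℕ} {m : ℕ} (t₀ : Tiling A₀ B₀ m) where

  grow : Vec Bool k → List ℕ × List ℕ
  grow []                  = A₀ , B₀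
  grow {suc k} (true ∷ v)  = map₁ (double (2 ^ k * m)) (grow v)
  grow {suc k} (false ∷ v) = map₂ (double (2 ^ k * m)) (grow v)

  grow-tiling : (v : Vec Bool k) → Tiling (proj₁ (grow v)) (proj₂ (grow v)) (2 ^ k * m)
  grow-tiling []                  = subst (Tiling A₀ B₀) (sym (+-identityʳ m)) t₀
  grow-tiling {suc k} (true ∷ v)  = subst (Tiling _ _) (2^k*m+2^k*m≡2^[1+k]*m k m) (Tiling-doubleˡ (grow-tiling v))
  grow-tiling {suc k} (false ∷ v) = subst (Tiling _ _) (2^k*m+2^k*m≡2^[1+k]*m k m) (Tiling-doubleʳ (grow-tiling v))

  length-grow : (v : Vec Bool k) → length (proj₁ (grow v)) ≡ length A₀ * 2 ^ count T? v
  length-grow []                  = sym (*-identityʳ (length A₀))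
  length-grow {suc k} (true ∷ v) =
    trans (length-double _ (proj₁ (grow v)))
          (trans (cong₂ _+_ (length-grow v) (length-grow v)) (twice (length A₀) (2 ^ count T? v)))
    where
    twice : ∀ a x → a * x + a * x ≡ a * (2 * x)
    twice = solve-∀
  length-grow {suc k} (false ∷ v) = length-grow v

  grow-injective : (v w : Vec Bool k) → grow v ≡ grow w → v ≡ w
  grow-injective [] [] _ = refl
  grow-injective (true ∷ v) (true ∷ w) eq = cong (true ∷_) (grow-injective v w (cong₂ _,_
    (double-injective (Tiling-boundedˡ (grow-tiling v)) (Tiling-boundedˡ (grow-tiling w)) (cong proj₁ eq))
    (cong proj₂ eq)))
  grow-injective (false ∷ v) (false ∷ w) eq = cong (false ∷_) (grow-injective v w (cong₂ _,_
    (cong proj₁ eq)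
    (double-injective (Tiling-boundedˡ (Tiling-swap (grow-tiling v))) (Tiling-boundedˡ (Tiling-swap (grow-tiling w))) (cong proj₂ eq))))
  grow-injective (true ∷ v) (false ∷ w) eq =
    ⊥-elim (∉-bound (Tiling-boundedˡ (grow-tiling w)) (subst (_ ∈_) (cong proj₁ eq) (m∈double (grow-tiling v .0∈A))))
  grow-injective (false ∷ v) (true ∷ w) eq =
    ⊥-elim (∉-bound (Tiling-boundedˡ (grow-tiling v)) (subst (_ ∈_) (cong proj₁ (sym eq)) (m∈double (grow-tiling w .0∈A))))

base-tiling : Tiling (0 ∷ 1 ∷ 2 ∷ []) (0 ∷ 3 ∷ 6 ∷ []) 9
base-tiling = record
  { A-sorted = toWitness {a? = Linked.linked? _<?_ (0 ∷ 1 ∷ 2 ∷ [])} _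
  ; B-sorted = toWitness {a? = Linked.linked? _<?_ (0 ∷ 3 ∷ 6 ∷ [])} _
  ; sum<     = λ a∈ b∈ → s≤s (+-mono-≤ (All.lookup A≤2 a∈) (All.lookup B≤6 b∈))
  ; covers   = base-covers
  ; card     = refl
  ; 0∈A      = here refl
  ; 0∈B      = here refl
  }
  where
  A≤2 : All (_≤ 2) (0 ∷ 1 ∷ 2 ∷ [])
  A≤2 = toWitness {a? = All.all? (_≤? 2) _} _
  B≤6 : All (_≤ 6) (0 ∷ 3 ∷ 6 ∷ [])
  B≤6 = toWitness {a? = All.all? (_≤? 6) _} _

  base-covers : ∀ {c} → c < 9 → ∃₂ λ a b → a ∈ (0 ∷ 1 ∷ 2 ∷ []) × b ∈ (0 ∷ 3 ∷ 6 ∷ []) × c ≡ a + b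
  base-covers {0} _ = 0 , 0 , here refl , here refl , refl
  base-covers {1} _ = 1 , 0 , there (here refl) , here refl , refl
  base-covers {2} _ = 2 , 0 , there (there (here refl)) , here refl , refl
  base-covers {3} _ = 0 , 3 , here refl , there (here refl) , refl
  base-covers {4} _ = 1 , 3 , there (here refl) , there (here refl) , refl
  base-covers {5} _ = 2 , 3 , there (there (here refl)) , there (here refl) , refl
  base-covers {6} _ = 0 , 6 , here refl , there (there (here refl)) , refl
  base-covers {7} _ = 1 , 6 , there (here refl) , there (there (here refl)) , refl
  base-covers {8} _ = 2 , 6 , there (there (here refl)) , there (there (here refl)) , refl
  base-covers {suc (suc (suc (suc (suc (suc (suc (suc (suc _))))))))} (s≤s (s≤s (s≤s (s≤s (s≤s (s≤s (s≤s (s≤s (s≤s ())))))))))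

-- Enumerates the words with exactly k letters true; Pascal's rule splits them by their first letter.
choose : ∀ n k → Fin (n C k) → Vec Bool n
choose-split : ∀ n k → Fin (n C k) ⊎ Fin (n C suc k) → Vec Bool (suc n)
choose n       zero    _ = replicate n false
choose (suc n) (suc k) i = choose-split n k (splitAt (n C k) (cast (sym (nCk+nC[k+1]≡[n+1]C[k+1] n k)) i))
choose-split n k (inj₁ i) = true ∷ choose n k i
choose-split n k (inj₂ i) = false ∷ choose n (suc k) i

count-choose : ∀ n k (i : Fin (n C k)) → count T? (choose n k i) ≡ k
count-choose-split : ∀ n k s → count T? (choose-split n k s) ≡ suc k
count-choose n       zero    _ = count-replicate-false n
  where
  count-replicate-false : ∀ n → count T? (replicate n false) ≡ 0
  count-replicate-false zero    = refl
  count-replicate-false (suc n) = count-replicate-false n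
count-choose (suc n) (suc k) i = count-choose-split n k (splitAt (n C k) (cast _ i))
count-choose-split n k (inj₁ i) = cong suc (count-choose n k i)
count-choose-split n k (inj₂ i) = count-choose n (suc k) i

splitAt-injective : ∀ m {n} {i j : Fin (m + n)} → splitAt m i ≡ splitAt m j → i ≡ j
splitAt-injective m {n} {i} {j} eq =
  trans (sym (join-splitAt m n i)) (trans (cong (join m n) eq) (join-splitAt m n j))

cast-injective : ∀ {m n} .(eq : m ≡ n) {i j : Fin m} → cast eq i ≡ cast eq j → i ≡ j
cast-injective eq {i} {j} cast-i≡cast-j =
  trans (sym (cast-involutive (sym eq) eq i)) (trans (cong (cast (sym eq)) cast-i≡cast-j) (cast-involutive (sym eq) eq j))

choose-injective : ∀ n k {i j : Fin (n C k)} → choose n k i ≡ choose n k j → i ≡ j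
choose-split-injective : ∀ n k {s t} → choose-split n k s ≡ choose-split n k t → s ≡ t
choose-injective n       zero    {Fin.zero} {Fin.zero} _ = refl
choose-injective (suc n) (suc k) eq = cast-injective _ (splitAt-injective (n C k) (choose-split-injective n k eq))
choose-split-injective n k {inj₁ i} {inj₁ j} eq = cong inj₁ (choose-injective n k (proj₂ (∷-injective eq)))
choose-split-injective n k {inj₂ i} {inj₂ j} eq = cong inj₂ (choose-injective n (suc k) (proj₂ (∷-injective eq)))

nCk≤[n+1]Ck : ∀ n k → n C k ≤ suc n C k
nCk≤[n+1]Ck n zero    = ≤-refl
nCk≤[n+1]Ck n (suc k) = ≤-trans (m≤n+m (n C suc k) (n C k)) (≤-reflexive (nCk+nC[k+1]≡[n+1]C[k+1] n k))

k≤n⇒0<nCk : k ≤ n → 0 < n C k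
k≤n⇒0<nCk {zero}  _         = s≤s z≤n
k≤n⇒0<nCk {suc k} (s≤s k≤n) =
  <-≤-trans (k≤n⇒0<nCk k≤n) (≤-trans (m≤m+n _ _) (≤-reflexive (nCk+nC[k+1]≡[n+1]C[k+1] _ k)))

-- Splitting n + m letters into the first n and the last m ones.
nCk*mCl≤[n+m]C[k+l] : ∀ n m k l → (n C k) * (m C l) ≤ (n + m) C (k + l)
nCk*mCl≤[n+m]C[k+l] zero    m zero    l = ≤-reflexive (+-identityʳ (m C l))
nCk*mCl≤[n+m]C[k+l] zero    m (suc k) l = z≤n
nCk*mCl≤[n+m]C[k+l] (suc n) m zero    l =
  ≤-trans (nCk*mCl≤[n+m]C[k+l] n m zero l) (nCk≤[n+1]Ck (n + m) l)
nCk*mCl≤[n+m]C[k+l] (suc n) m (suc k) l = begin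
  (suc n C suc k) * (m C l)                 ≡⟨ cong (_* (m C l)) (nCk+nC[k+1]≡[n+1]C[k+1] n k) ⟨
  (n C k + n C suc k) * (m C l)             ≡⟨ *-distribʳ-+ (m C l) (n C k) (n C suc k) ⟩
  (n C k) * (m C l) + (n C suc k) * (m C l) ≤⟨ +-mono-≤ (nCk*mCl≤[n+m]C[k+l] n m k l) (nCk*mCl≤[n+m]C[k+l] n m (suc k) l) ⟩
  (n + m) C (k + l) + (n + m) C suc (k + l) ≡⟨ nCk+nC[k+1]≡[n+1]C[k+1] (n + m) (k + l) ⟩
  suc (n + m) C suc (k + l)                 ∎
  where open ≤-Reasoning

[nCk]^q≤[qn+m]C[qk+l] : ∀ {l m} n k q → l ≤ m → (n C k) ^ q ≤ (q * n + m) C (q * k + l)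
[nCk]^q≤[qn+m]C[qk+l] n k zero    l≤m = k≤n⇒0<nCk l≤m
[nCk]^q≤[qn+m]C[qk+l] {l} {m} n k (suc q) l≤m = begin
  (n C k) * (n C k) ^ q                 ≤⟨ *-monoʳ-≤ (n C k) ([nCk]^q≤[qn+m]C[qk+l] n k q l≤m) ⟩
  (n C k) * ((q * n + m) C (q * k + l)) ≤⟨ nCk*mCl≤[n+m]C[k+l] n (q * n + m) k (q * k + l) ⟩
  (n + (q * n + m)) C (k + (q * k + l)) ≡⟨ cong₂ _C_ (+-assoc n (q * n) m) (+-assoc k (q * k) l) ⟨
  (suc q * n + m) C (suc q * k + l)     ∎
  where open ≤-Reasoning

k≡[k/16]*16+k%16 : ∀ k → k ≡ k / 16 * 16 + k % 16
k≡[k/16]*16+k%16 k = trans (m≡m%n+[m/n]*n k 16) (+-comm (k % 16) _)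

k/2≡[k/16]*8+k%16/2 : ∀ k → k / 2 ≡ k / 16 * 8 + k % 16 / 2
k/2≡[k/16]*8+k%16/2 k = begin
  k / 2                 ≡⟨ cong (_/ 2) (m≡m%n+[m/n]*n k 16) ⟩
  (r + q * 16) / 2      ≡⟨ cong (λ x → (r + x) / 2) (*-assoc q 8 2) ⟨
  (r + q * 8 * 2) / 2   ≡⟨ +-distrib-/-∣ʳ r (divides-refl (q * 8)) ⟩
  r / 2 + q * 8 * 2 / 2 ≡⟨ cong (r / 2 +_) (m*n/n≡m (q * 8) 2) ⟩
  r / 2 + q * 8         ≡⟨ +-comm (r / 2) (q * 8) ⟩
  q * 8 + r / 2         ∎
  where
  open ≡-Reasoning
  q r : ℕ
  q = k / 16
  r = k % 16

central-binomial-bound : ∀ k → (16 C 8) ^ (k / 16) ≤ k C (k / 2)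
central-binomial-bound k =
  subst₂ (λ n l → (16 C 8) ^ (k / 16) ≤ n C l) (sym (k≡[k/16]*16+k%16 k)) (sym (k/2≡[k/16]*8+k%16/2 k))
         ([nCk]^q≤[qn+m]C[qk+l] 16 8 (k / 16) (m/n≤m (k % 16) 2))

n<2^n : ∀ n → n < 2 ^ n
n<2^n zero    = s≤s z≤n
n<2^n (suc n) = ≤-trans (+-mono-≤ (m^n>0 2 n) (n<2^n n)) (≤-reflexive (cong (2 ^ n +_) (sym (+-identityʳ (2 ^ n)))))

M^100*2^1185<2^[q*101] : ∀ M q → M + 12 ≤ q → M ^ 100 * 2 ^ 1185 < 2 ^ (q * 101)
M^100*2^1185<2^[q*101] M q M+12≤q = begin-strict
  M ^ 100 * 2 ^ 1185         <⟨ *-monoˡ-< (2 ^ 1185) {{m^n≢0 2 1185}} (^-monoˡ-< 100 (n<2^n M)) ⟩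
  (2 ^ M) ^ 100 * 2 ^ 1185   ≡⟨ cong (_* 2 ^ 1185) (^-*-assoc 2 M 100) ⟩
  2 ^ (M * 100) * 2 ^ 1185   ≡⟨ ^-distribˡ-+-* 2 (M * 100) 1185 ⟨
  2 ^ (M * 100 + 1185)       ≤⟨ ^-monoʳ-≤ 2 (≤-trans exponent-bound (*-monoˡ-≤ 101 M+12≤q)) ⟩
  2 ^ (q * 101)              ∎
  where
  open ≤-Reasoning
  exponent-split : ∀ M → (M + 12) * 101 ≡ (M * 100 + 1185) + (M + 27)
  exponent-split = solve-∀
  exponent-bound : M * 100 + 1185 ≤ (M + 12) * 101
  exponent-bound = ≤-trans (m≤m+n _ (M + 27)) (≤-reflexive (sym (exponent-split M)))

2^1365≤12870^100 : 2 ^ 1365 ≤ 12870 ^ 100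
2^1365≤12870^100 = ≤ᵇ⇒≤ (2 ^ 1365) (12870 ^ 100) _

-- 12870 = 16 C 8 exceeds 2^13.65, while 79 · 16 = 1264 < 1365; the surplus 2^(101 q) absorbs M^100.
M^100*2^[79k]<[12870^q]^100 : ∀ M q k → M + 12 ≤ q → k ≤ q * 16 + 15 → M ^ 100 * 2 ^ (79 * k) < (12870 ^ q) ^ 100
M^100*2^[79k]<[12870^q]^100 M q k M+12≤q k≤16q+15 = begin-strict
  M ^ 100 * 2 ^ (79 * k)                  ≤⟨ *-monoʳ-≤ (M ^ 100) (^-monoʳ-≤ 2 (*-monoʳ-≤ 79 k≤16q+15)) ⟩
  M ^ 100 * 2 ^ (79 * (q * 16 + 15))      ≡⟨ cong (λ e → M ^ 100 * 2 ^ e) (split₁ q) ⟩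
  M ^ 100 * 2 ^ (q * 1264 + 1185)         ≡⟨ cong (M ^ 100 *_) (^-distribˡ-+-* 2 (q * 1264) 1185) ⟩
  M ^ 100 * (2 ^ (q * 1264) * 2 ^ 1185)   ≡⟨ x*[y*z]≡y*[x*z] (M ^ 100) (2 ^ (q * 1264)) (2 ^ 1185) ⟩
  2 ^ (q * 1264) * (M ^ 100 * 2 ^ 1185)   <⟨ *-monoʳ-< (2 ^ (q * 1264)) {{m^n≢0 2 (q * 1264)}} (M^100*2^1185<2^[q*101] M q M+12≤q) ⟩
  2 ^ (q * 1264) * 2 ^ (q * 101)          ≡⟨ ^-distribˡ-+-* 2 (q * 1264) (q * 101) ⟨
  2 ^ (q * 1264 + q * 101)                ≡⟨ cong (2 ^_) (split₂ q) ⟨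
  2 ^ (1365 * q)                          ≡⟨ ^-*-assoc 2 1365 q ⟨
  (2 ^ 1365) ^ q                          ≤⟨ ^-monoˡ-≤ q 2^1365≤12870^100 ⟩
  (12870 ^ 100) ^ q                       ≡⟨ ^-*-assoc 12870 100 q ⟩
  12870 ^ (100 * q)                       ≡⟨ cong (12870 ^_) (*-comm 100 q) ⟩
  12870 ^ (q * 100)                       ≡⟨ ^-*-assoc 12870 q 100 ⟨
  (12870 ^ q) ^ 100                       ∎
  where
  open ≤-Reasoning
  split₁ : ∀ q → 79 * (q * 16 + 15) ≡ q * 1264 + 1185
  split₁ = solve-∀
  split₂ : ∀ q → 1365 * q ≡ q * 1264 + q * 101
  split₂ = solve-∀
  x*[y*z]≡y*[x*z] : ∀ x y z → x * (y * z) ≡ y * (x * z)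
  x*[y*z]≡y*[x*z] = solve-∀

growth-bound : ∀ M k → (M + 12) * 16 ≤ k → M ^ 100 * 2 ^ (79 * k) < ((16 C 8) ^ (k / 16)) ^ 100
growth-bound M k [M+12]*16≤k = M^100*2^[79k]<[12870^q]^100 M (k / 16) k M+12≤k/16 k≤[k/16]*16+15
  where
  M+12≤k/16 : M + 12 ≤ k / 16
  M+12≤k/16 = subst (_≤ k / 16) (m*n/n≡m (M + 12) 16) (/-monoˡ-≤ 16 [M+12]*16≤k)
  k≤[k/16]*16+15 : k ≤ k / 16 * 16 + 15
  k≤[k/16]*16+15 = subst (_≤ k / 16 * 16 + 15) (sym (k≡[k/16]*16+k%16 k)) (+-monoʳ-≤ (k / 16 * 16) (≤-pred (m%n<n k 16)))

-- Defs works in [1, n] ⊂ ℤ, so A is shifted up by one.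
Tiling⇒TPair : Tiling A B n → length A ≡ α → TPair α n
Tiling⇒TPair {A} {B} {n} t |A|≡α = record
  { A        = map (pos ∘ suc) A
  ; B        = map pos B
  ; A-sorted = Linked-map⁺ (Linked.map (+<+ ∘ s≤s) (t .A-sorted))
  ; B-sorted = Linked-map⁺ (Linked.map +<+ (t .B-sorted))
  ; sumset   = λ c → mk⇔ (sum∈interval c) (interval∈sum c)
  ; card     = trans (sym (t .card)) (cong₂ _*_ (sym (length-map _ A)) (sym (length-map pos B)))
  ; cardA    = trans (length-map _ A) |A|≡α
  ; zero∈B   = ∈-map⁺ pos (t .0∈B)
  ; B-nonneg = All.tabulate λ b∈ → nonneg (∈-map⁻ pos b∈)
  }
  where
  nonneg : ∀ {x} → ∃[ b ] (b ∈ B × x ≡ pos b) → ℤ.0ℤ ℤ.≤ x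
  nonneg (b , _ , refl) = +≤+ z≤n
  sum∈interval : ∀ c → InSumset (map (pos ∘ suc) A) (map pos B) c → InInterval n c
  sum∈interval c (_ , _ , a∈ , b∈ , refl) with ∈-map⁻ (pos ∘ suc) a∈ | ∈-map⁻ pos b∈
  ... | a , a∈A , refl | b , b∈B , refl = +≤+ (s≤s z≤n) , +≤+ (t .sum< a∈A b∈B)
  interval∈sum : ∀ c → InInterval n c → InSumset (map (pos ∘ suc) A) (map pos B) c
  interval∈sum (pos zero)  (+≤+ () , _)
  interval∈sum (pos (suc c)) (_ , +≤+ c<n) with t .covers c<n
  ... | a , b , a∈A , b∈B , refl = pos (suc a) , pos b , ∈-map⁺ (pos ∘ suc) a∈A , ∈-map⁺ pos b∈B , refl
  interval∈sum -[1+ c ]  (() , _)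

AtLeast-≤ : N ≤ N′ → AtLeast N′ α n → AtLeast N α n
AtLeast-≤ N≤N′ (f , f-injective) =
  (λ i → f (inject≤ i N≤N′)) ,
  λ i j A≡ B≡ → inject≤-injective N≤N′ N≤N′ i j (f-injective _ _ A≡ B≡)

central-tilings : ∀ k → AtLeast (k C (k / 2)) (αₖ k) (2 ^ k * 9)
central-tilings k = pair , pair-injective
  where
  open Doubling base-tiling
  word : Fin (k C (k / 2)) → Vec Bool k
  word = choose k (k / 2)
  pair : Fin (k C (k / 2)) → TPair (αₖ k) (2 ^ k * 9)
  pair i = Tiling⇒TPair (grow-tiling (word i)) (trans (length-grow (word i)) (cong (λ j → 3 * 2 ^ j) (count-choose k (k / 2) i)))
  pair-injective : ∀ i j → TPair.A (pair i) ≡ TPair.A (pair j) → TPair.B (pair i) ≡ TPair.B (pair j) → i ≡ j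
  pair-injective i j A≡ B≡ = choose-injective k (k / 2) (grow-injective (word i) (word j)
    (cong₂ _,_ (map-injective (suc-injective ∘ +-injective) A≡) (map-injective +-injective B≡)))

lemma11 : (M : ℕ) → ∃[ K ] (∀ k → K ≤ k →
              ∃[ N ] ((M ^ 100 * 2 ^ (79 * k) < N ^ 100) × AtLeast N (αₖ k) (2 ^ k * 9)))
lemma11 M = (M + 12) * 16 , λ k [M+12]*16≤k →
  (16 C 8) ^ (k / 16) ,
  growth-bound M k [M+12]*16≤k ,
  AtLeast-≤ (central-binomial-bound k) (central-tilings k)
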